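{- $\alpha_{\mathbb{Z}}(3)\geq\frac{1}{2}$ and $\beta_{\mathbb{Z}}(3)\geq\frac{1}{6}$.
   Context: Let $S\subseteq\mathbb{Z}$. A permutation of $S$ is a sequence $p_1,p_2,\dots$ in which every element of $S$ appears exactly once. It contains an arithmetic progression of length $k$ if there are indices $i_1<\dots<i_k$ and integers $a$ and $d\neq 0$ (possibly negative) with $p_{i_j}=a+(j-1)d$ for all $j$. $S$ can be permuted to avoid arithmetic progressions of length $k$ if some permutation of $S$ contains no such progression. $\alpha_{\mathbb{Z}}(k)$ is the supremum of $\limsup_{n\to\infty}\frac{|S\cap[-n,n]|}{2n}$, and $\beta_{\mathbb{Z}}(k)$ is the supremum of $\liminf_{n\to\infty}\frac{|S\cap[-n,n]|}{2n}$, each supremum taken over all sets $S\subseteq\mathbb{Z}$ that can be permuted to avoid arithmetic progressions of length $k$. -}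

module Defs where

open import Data.Bool using (Bool; true; false; if_then_else_)
open import Data.Nat using (ℕ; zero; suc; _<_) renaming (_+_ to _+ℕ_; _*_ to _*ℕ_)
open import Data.Integer using (ℤ; +_; _+_; _-_; 0ℤ)
open import Data.List using (List; map; upTo)
open import Data.Nat.ListAction using (sum)
open import Data.Product using (Σ; ∃; _×_; _,_)
open import Data.Empty using (⊥)
open import Relation.Nullary using (¬_)
open import Relation.Binary.PropositionalEquality using (_≡_; _≢_)
open import Data.Rational using (ℚ; _/_)

Subset : Set
Subset = ℤ → Bool

_∈S_ : ℤ → Subset → Set
x ∈S S = S x ≡ true

record PermutationOf (S : Subset) : Set where
  field
    seq       : ℕ → ℤ
    injective : ∀ i j → seq i ≡ seq j → i ≡ j
    inS       : ∀ i → seq i ∈S S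
    onto      : ∀ x → x ∈S S → ∃ λ i → seq i ≡ x
open PermutationOf public

Contains3AP : (ℕ → ℤ) → Set
Contains3AP p =
  Σ ℕ λ i → Σ ℕ λ j → Σ ℕ λ k → Σ ℤ λ a → Σ ℤ λ d →
    i < j × j < k × d ≢ 0ℤ ×
    p i ≡ a × p j ≡ a + d × p k ≡ a + d + d

Avoids3AP : Subset → Set
Avoids3AP S = Σ (PermutationOf S) λ π → ¬ Contains3AP (seq π)

-- |S ∩ [-n, n]|
count : Subset → ℕ → ℕ
count S n = sum (map (λ i → if S (+ i - + n) then 1 else 0) (upTo (suc (2 *ℕ n))))

-- |S ∩ [-m, m]| / (2m) for m = suc n ≥ 1
density : Subset → ℕ → ℚ
density S n = (+ count S (suc n)) / (2 *ℕ suc n)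

module Submission where

-- Let M₀ = 0 and M_{m+1} = 5·M_m + 1.  Block m consists of the magnitudes x
-- with 3·M_m < x ≤ M_{m+1} (2·M_m + 1 of them), and S = {0} ∪ ±(blocks).
-- S is enumerated as 0, then block 0, block 1, …; inside a block first the
-- positive, then the negative entries, each in the classical AP-free order of
-- an interval (evens before odds, recursively).

module Halving where

  open import Data.Nat
  open import Data.Nat.Properties
  open import Data.Product using (∃; _,_)
  open import Data.Sum using (_⊎_; inj₁; inj₂)
  open import Relation.Nullary using (contradiction)
  open import Relation.Binary.Definitions using (tri<; tri≈; tri>)
  open import Relation.Binary.PropositionalEquality

  double-injective : ∀ x y → x + x ≡ y + y → x ≡ y
  double-injective x y e with <-cmp x y
  ... | tri< x<y _ _ = contradiction e (<⇒≢ (+-mono-< x<y x<y))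
  ... | tri≈ _ x≡y _ = x≡y
  ... | tri> _ _ y<x = contradiction (sym e) (<⇒≢ (+-mono-< y<x y<x))

  double≢odd : ∀ x y → x + x ≢ suc (y + y)
  double≢odd x y e = even≢odd x y
    (subst₂ (λ a b → x + a ≡ suc (y + b)) (sym (+-identityʳ x)) (sym (+-identityʳ y)) e)

  even-or-odd : ∀ x → ∃ λ y → x ≡ y + y ⊎ x ≡ suc (y + y)
  even-or-odd zero = 0 , inj₁ refl
  even-or-odd (suc x) with even-or-odd x
  ... | y , inj₁ e = y , inj₂ (cong suc e)
  ... | y , inj₂ e = suc y , inj₁ (trans (cong suc e) (cong suc (sym (+-suc y y))))

  -- Among 0 … N-1 there are ⌈N/2⌉ even and ⌊N/2⌋ odd numbers:
  -- x < ⌈N/2⌉ iff 2x < N, and x < ⌊N/2⌋ iff 2x+1 < N.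
  <⌈/2⌉⇒double< : ∀ N x → x < ⌈ N /2⌉ → x + x < N
  <⌈/2⌉⇒double< (suc zero)    zero    _         = s≤s z≤n
  <⌈/2⌉⇒double< (suc zero)    (suc x) (s≤s ())
  <⌈/2⌉⇒double< (suc (suc N)) zero    _         = s≤s z≤n
  <⌈/2⌉⇒double< (suc (suc N)) (suc x) (s≤s lt) rewrite +-suc x x =
    s≤s (s≤s (<⌈/2⌉⇒double< N x lt))

  double<⇒<⌈/2⌉ : ∀ N x → x + x < N → x < ⌈ N /2⌉
  double<⇒<⌈/2⌉ (suc zero)    zero    _         = s≤s z≤n
  double<⇒<⌈/2⌉ (suc zero)    (suc x) (s≤s ())
  double<⇒<⌈/2⌉ (suc (suc N)) zero    _         = s≤s z≤n
  double<⇒<⌈/2⌉ (suc (suc N)) (suc x) (s≤s lt) rewrite +-suc x x =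
    s≤s (double<⇒<⌈/2⌉ N x (s≤s⁻¹ lt))

  <⌊/2⌋⇒odd< : ∀ N x → x < ⌊ N /2⌋ → suc (x + x) < N
  <⌊/2⌋⇒odd< (suc (suc N)) zero    _         = s≤s (s≤s z≤n)
  <⌊/2⌋⇒odd< (suc (suc N)) (suc x) (s≤s lt) rewrite +-suc x x =
    s≤s (s≤s (<⌊/2⌋⇒odd< N x lt))

  odd<⇒<⌊/2⌋ : ∀ N x → suc (x + x) < N → x < ⌊ N /2⌋
  odd<⇒<⌊/2⌋ (suc zero)    x       (s≤s ())
  odd<⇒<⌊/2⌋ (suc (suc N)) zero    _         = s≤s z≤n
  odd<⇒<⌊/2⌋ (suc (suc N)) (suc x) (s≤s lt) rewrite +-suc x x =
    s≤s (odd<⇒<⌊/2⌋ N x (s≤s⁻¹ lt))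

  upper-half< : ∀ N t → ⌈ N /2⌉ ≤ t → t < N → t ∸ ⌈ N /2⌉ < ⌊ N /2⌋
  upper-half< N t h lt = subst (t ∸ ⌈ N /2⌉ <_) halves (∸-monoˡ-< lt h)
    where
    halves : N ∸ ⌈ N /2⌉ ≡ ⌊ N /2⌋
    halves = trans (cong (_∸ ⌈ N /2⌉) (sym (⌊n/2⌋+⌈n/2⌉≡n N))) (m+n∸n≡m ⌊ N /2⌋ ⌈ N /2⌉)

  -- Halving consumes one unit of recursion fuel.
  ⌈/2⌉-fuel : ∀ N f → N ≤ suc (suc f) → ⌈ N /2⌉ ≤ suc f
  ⌈/2⌉-fuel zero          f _        = z≤n
  ⌈/2⌉-fuel (suc zero)    f _        = s≤s z≤n
  ⌈/2⌉-fuel (suc (suc N)) f (s≤s le) = ≤-trans (s≤s⁻¹ (⌈n/2⌉<n N)) le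

  ⌊/2⌋-fuel : ∀ N f → N ≤ suc (suc f) → ⌊ N /2⌋ ≤ suc f
  ⌊/2⌋-fuel N f le = ≤-trans (⌊n/2⌋≤⌈n/2⌉ N) (⌈/2⌉-fuel N f le)

module APFreeOrder where

  open import Data.Nat
  open import Data.Nat.Properties
  open import Data.Product using (Σ; _×_; _,_)
  open import Data.Sum using (inj₁; inj₂)
  open import Data.Empty using (⊥-elim)
  open import Relation.Nullary using (yes; no)
  open import Relation.Binary.PropositionalEquality
  open import Data.Nat.Tactic.RingSolver using (solve-∀)
  open Halving

  -- order f N t is the t-th term of the classical AP-free listing of
  -- {0, …, N-1}: first the even numbers 2x, x running through the listing
  -- of {0, …, ⌈N/2⌉-1}, then the odd numbers 2x+1, x through the listing
  -- of {0, …, ⌊N/2⌋-1}.  The fuel f bounds the recursion (f ≥ N - 1).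
  order : ℕ → ℕ → ℕ → ℕ
  order zero    N t = 0
  order (suc f) N t with t <? ⌈ N /2⌉
  ... | yes _ = order f ⌈ N /2⌉ t + order f ⌈ N /2⌉ t
  ... | no  _ = suc (order f ⌊ N /2⌋ (t ∸ ⌈ N /2⌉) + order f ⌊ N /2⌋ (t ∸ ⌈ N /2⌉))

  data Half (f N t : ℕ) : ℕ → Set where
    even-half : t < ⌈ N /2⌉ →
      Half f N t (order f ⌈ N /2⌉ t + order f ⌈ N /2⌉ t)
    odd-half  : ⌈ N /2⌉ ≤ t →
      Half f N t (suc (order f ⌊ N /2⌋ (t ∸ ⌈ N /2⌉) + order f ⌊ N /2⌋ (t ∸ ⌈ N /2⌉)))

  half : ∀ f N t → Half f N t (order (suc f) N t)
  half f N t with t <? ⌈ N /2⌉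
  ... | yes t< = even-half t<
  ... | no  t≮ = odd-half (≮⇒≥ t≮)

  order-< : ∀ f N t → N ≤ suc f → t < N → order f N t < N
  order-< zero    N t _  lt = ≤-trans (s≤s z≤n) lt
  order-< (suc f) N t le lt with order (suc f) N t | half f N t
  ... | _ | even-half p = <⌈/2⌉⇒double< N _ (order-< f _ t (⌈/2⌉-fuel N f le) p)
  ... | _ | odd-half p  =
    <⌊/2⌋⇒odd< N _ (order-< f _ _ (⌊/2⌋-fuel N f le) (upper-half< N t p lt))

  order-injective : ∀ f N t t′ → N ≤ suc f → t < N → t′ < N →
                    order f N t ≡ order f N t′ → t ≡ t′
  order-injective zero N t t′ le lt lt′ _ =
    trans (n<1⇒n≡0 (≤-trans lt le)) (sym (n<1⇒n≡0 (≤-trans lt′ le)))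
  order-injective (suc f) N t t′ le lt lt′ e
    with order (suc f) N t | half f N t | order (suc f) N t′ | half f N t′
  ... | _ | even-half p | _ | even-half p′ =
    order-injective f _ t t′ (⌈/2⌉-fuel N f le) p p′
      (double-injective (order f ⌈ N /2⌉ t) (order f ⌈ N /2⌉ t′) e)
  ... | _ | even-half _ | _ | odd-half _  =
    ⊥-elim (double≢odd (order f ⌈ N /2⌉ t) (order f ⌊ N /2⌋ (t′ ∸ ⌈ N /2⌉)) e)
  ... | _ | odd-half _  | _ | even-half _ =
    ⊥-elim (double≢odd (order f ⌈ N /2⌉ t′) (order f ⌊ N /2⌋ (t ∸ ⌈ N /2⌉)) (sym e))
  ... | _ | odd-half p  | _ | odd-half p′ =
    trans (sym (m∸n+n≡m p)) (trans (cong (_+ ⌈ N /2⌉) shifted) (m∸n+n≡m p′))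
    where
    shifted : t ∸ ⌈ N /2⌉ ≡ t′ ∸ ⌈ N /2⌉
    shifted = order-injective f _ _ _ (⌊/2⌋-fuel N f le)
      (upper-half< N t p lt) (upper-half< N t′ p′ lt′)
      (double-injective (order f ⌊ N /2⌋ (t ∸ ⌈ N /2⌉)) (order f ⌊ N /2⌋ (t′ ∸ ⌈ N /2⌉))
        (suc-injective e))

  order-surjective : ∀ f N x → N ≤ suc f → x < N → Σ ℕ λ t → t < N × order f N t ≡ x
  order-surjective zero N x le lt = 0 , ≤-trans (s≤s z≤n) lt , sym (n<1⇒n≡0 (≤-trans lt le))
  order-surjective (suc f) N x le lt with even-or-odd x
  ... | y , inj₁ refl
    with order-surjective f ⌈ N /2⌉ y (⌈/2⌉-fuel N f le) (double<⇒<⌈/2⌉ N y lt)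
  ...   | t , t< , refl with order (suc f) N t in e | half f N t
  ...     | _ | even-half _ = t , <-≤-trans t< (⌈n/2⌉≤n N) , e
  ...     | _ | odd-half p  = ⊥-elim (<⇒≱ t< p)
  order-surjective (suc f) N x le lt | y , inj₂ refl
    with order-surjective f ⌊ N /2⌋ y (⌊/2⌋-fuel N f le) (odd<⇒<⌊/2⌋ N y lt)
  ... | t , t< , refl with order (suc f) N (t + ⌈ N /2⌉) in e | half f N (t + ⌈ N /2⌉)
  ...   | _ | even-half p = ⊥-elim (<⇒≱ p (m≤n+m _ t))
  ...   | _ | odd-half _  = t + ⌈ N /2⌉ , in-range ,
          trans e (cong (λ z → suc (order f ⌊ N /2⌋ z + order f ⌊ N /2⌋ z)) (m+n∸n≡m t ⌈ N /2⌉))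
    where
    in-range : t + ⌈ N /2⌉ < N
    in-range = subst (t + ⌈ N /2⌉ <_) (⌊n/2⌋+⌈n/2⌉≡n N) (+-monoˡ-< ⌈ N /2⌉ t<)

  swap : ∀ a c → (a + a) + (c + c) ≡ (a + c) + (a + c)
  swap = solve-∀
  even+odd : ∀ a c → (a + a) + suc (c + c) ≡ suc ((a + c) + (a + c))
  even+odd = solve-∀
  odd+odd : ∀ a c → suc (a + a) + suc (c + c) ≡ suc (suc ((a + c) + (a + c)))
  odd+odd = solve-∀

  -- The listing has no 3-term AP in positional order i < j < k: within one
  -- half this is the induction hypothesis (after halving), and a first term
  -- from the even half with a third term from the odd half has an odd sum.
  order-AP-free : ∀ f N i j k → N ≤ suc f → i < j → j < k → k < N →
                  order f N i + order f N k ≢ order f N j + order f N j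
  order-AP-free zero N i j k le i<j j<k k<N _ =
    <⇒≱ (<-trans (≤-<-trans z≤n i<j) j<k) (s≤s⁻¹ (≤-trans k<N le))
  order-AP-free (suc f) N i j k le i<j j<k k<N e
    with order (suc f) N i | half f N i | order (suc f) N j | half f N j
       | order (suc f) N k | half f N k
  ... | _ | even-half _  | _ | even-half _ | _ | even-half k< =
    order-AP-free f _ i j k (⌈/2⌉-fuel N f le) i<j j<k k<
      (double-injective (a + c) (b + b) (trans (sym (swap a c)) (trans e (swap b b))))
    where
    a b c : ℕ
    a = order f ⌈ N /2⌉ i
    b = order f ⌈ N /2⌉ j
    c = order f ⌈ N /2⌉ k
  ... | _ | even-half _  | y | _ | _ | odd-half _ =
    double≢odd y (a + c) (trans (sym e) (even+odd a c))
    where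
    a c : ℕ
    a = order f ⌈ N /2⌉ i
    c = order f ⌊ N /2⌋ (k ∸ ⌈ N /2⌉)
  ... | _ | odd-half i≥  | _ | _ | _ | even-half k< = <⇒≱ (<-trans i<j j<k) (≤-trans (<⇒≤ k<) i≥)
  ... | _ | even-half _  | _ | odd-half j≥ | _ | even-half k< = <⇒≱ j<k (≤-trans (<⇒≤ k<) j≥)
  ... | _ | odd-half i≥  | _ | even-half j< | _ | _ = <⇒≱ i<j (≤-trans (<⇒≤ j<) i≥)
  ... | _ | odd-half i≥  | _ | odd-half j≥ | _ | odd-half k≥ =
    order-AP-free f _ (i ∸ h) (j ∸ h) (k ∸ h) (⌊/2⌋-fuel N f le)
      (∸-monoˡ-< i<j i≥) (∸-monoˡ-< j<k j≥) (upper-half< N k k≥ k<N)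
      (double-injective (a + c) (b + b)
        (suc-injective (suc-injective (trans (sym (odd+odd a c)) (trans e (odd+odd b b))))))
    where
    h a b c : ℕ
    h = ⌈ N /2⌉
    a = order f ⌊ N /2⌋ (i ∸ h)
    b = order f ⌊ N /2⌋ (j ∸ h)
    c = order f ⌊ N /2⌋ (k ∸ h)

  listing : ℕ → ℕ → ℕ
  listing N = order N N

  listing-< : ∀ N t → t < N → listing N t < N
  listing-< N t = order-< N N t (n≤1+n N)

  listing-injective : ∀ N t t′ → t < N → t′ < N → listing N t ≡ listing N t′ → t ≡ t′
  listing-injective N t t′ = order-injective N N t t′ (n≤1+n N)

  listing-surjective : ∀ N x → x < N → Σ ℕ λ t → t < N × listing N t ≡ x
  listing-surjective N x = order-surjective N N x (n≤1+n N)

  listing-AP-free : ∀ N i j k → i < j → j < k → k < N →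
                    listing N i + listing N k ≢ listing N j + listing N j
  listing-AP-free N i j k = order-AP-free N N i j k (n≤1+n N)

module Blocks where

  open import Data.Nat
  open import Data.Nat.Properties
  open import Data.Bool using (Bool; true; false)
  open import Data.Integer as ℤ using (ℤ; +_)
  open import Data.Product using (_×_; _,_)
  open import Data.Sum using (inj₁; inj₂)
  open import Data.Empty using (⊥-elim)
  open import Relation.Nullary using (yes; no)
  open import Relation.Binary.Definitions using (tri<; tri≈; tri>)
  open import Relation.Binary.PropositionalEquality
  open APFreeOrder

  -- Scales M₀ = 0, M_{m+1} = 5·M_m + 1.  Block m is the set of magnitudes x
  -- with base m < x ≤ M_{m+1}, where base m = 3·M_m; it has width 2·M_m + 1.
  M : ℕ → ℕ
  M zero    = 0
  M (suc m) = suc (M m + M m + M m + (M m + M m))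

  base : ℕ → ℕ
  base m = M m + M m + M m

  width : ℕ → ℕ
  width m = suc (M m + M m)

  M-suc : ∀ m → M (suc m) ≡ base m + width m
  M-suc m = sym (+-suc (base m) (M m + M m))

  M≤base : ∀ m → M m ≤ base m
  M≤base m = ≤-trans (m≤m+n (M m) (M m)) (m≤m+n _ (M m))

  base<M-suc : ∀ m → base m < M (suc m)
  base<M-suc m = s≤s (m≤m+n (base m) _)

  M-mono : ∀ {m m′} → m ≤ m′ → M m ≤ M m′
  M-mono {m} {zero}   z≤n = ≤-refl
  M-mono {m} {suc m′} le with m≤n⇒m<n∨m≡n le
  ... | inj₁ lt   = ≤-trans (M-mono (s≤s⁻¹ lt)) (≤-trans (M≤base m′) (<⇒≤ (base<M-suc m′)))
  ... | inj₂ refl = ≤-refl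

  m≤M : ∀ m → m ≤ M m
  m≤M zero    = z≤n
  m≤M (suc m) = s≤s (≤-trans (m≤M m) (≤-trans (M≤base m) (m≤m+n _ _)))

  magnitude : ℕ → ℕ → ℕ
  magnitude m q = suc (base m + listing (width m) q)

  magnitude-> : ∀ m q → base m < magnitude m q
  magnitude-> m q = s≤s (m≤m+n (base m) _)

  magnitude-≤ : ∀ m q → q < width m → magnitude m q ≤ M (suc m)
  magnitude-≤ m q lt = subst (magnitude m q ≤_) (sym (M-suc m))
    (subst (_≤ base m + width m) (+-suc (base m) _) (+-monoʳ-≤ (base m) (listing-< (width m) q lt)))

  magnitude-separated : ∀ {m m′} q q′ → m < m′ → q < width m → magnitude m q < magnitude m′ q′
  magnitude-separated {m} {m′} q q′ m<m′ lt =
    ≤-<-trans (≤-trans (magnitude-≤ m q lt) (≤-trans (M-mono m<m′) (M≤base m′))) (magnitude-> m′ q′)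

  magnitude-injective : ∀ m q m′ q′ → q < width m → q′ < width m′ →
                        magnitude m q ≡ magnitude m′ q′ → m ≡ m′ × q ≡ q′
  magnitude-injective m q m′ q′ lt lt′ e with <-cmp m m′
  ... | tri< m<m′ _ _ = ⊥-elim (<⇒≢ (magnitude-separated q q′ m<m′ lt) e)
  ... | tri> _ _ m′<m = ⊥-elim (<⇒≢ (magnitude-separated q′ q m′<m lt′) (sym e))
  ... | tri≈ _ refl _ =
    refl , listing-injective (width m) q q′ lt lt′ (+-cancelˡ-≡ (base m) _ _ (suc-injective e))

  signed : Bool → ℕ → ℤ
  signed true  x = + x
  signed false x = ℤ.- (+ x)

  -- Inside block m the positive entries come first, then the negative ones,
  -- each in the order of the listing: the entry of sign σ and rank q sits at
  -- offset (offset σ (width m) q).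
  offset : Bool → ℕ → ℕ → ℕ
  offset true  w q = q
  offset false w q = w + q

  offset-< : ∀ σ {w q} → q < w → offset σ w q < w + w
  offset-< true  {w} lt = ≤-trans lt (m≤m+n w w)
  offset-< false {w} lt = +-monoʳ-< w lt

  offset-cancel-< : ∀ σ {w q q′} → offset σ w q < offset σ w q′ → q < q′
  offset-cancel-< true                 lt = lt
  offset-cancel-< false {w} {q} {q′} lt = +-cancelˡ-< w q q′ lt

  blockEntry : ℕ → ℕ → ℤ
  blockEntry m o with o <? width m
  ... | yes _ = signed true  (magnitude m o)
  ... | no  _ = signed false (magnitude m (o ∸ width m))

  data BlockEntry (m o : ℕ) : ℤ → Set where
    entry : ∀ σ q → q < width m → o ≡ offset σ (width m) q →
            BlockEntry m o (signed σ (magnitude m q))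

  blockEntry-view : ∀ m o → o < width m + width m → BlockEntry m o (blockEntry m o)
  blockEntry-view m o lt with o <? width m
  ... | yes o< = entry true o o< refl
  ... | no  o≮ = entry false (o ∸ width m) rank< (sym (m+[n∸m]≡n o≥))
    where
    o≥ : width m ≤ o
    o≥ = ≮⇒≥ o≮
    rank< : o ∸ width m < width m
    rank< = subst (o ∸ width m <_) (m+n∸m≡n (width m) (width m)) (∸-monoˡ-< lt o≥)

  blockEntry-at : ∀ m σ q → q < width m → blockEntry m (offset σ (width m) q) ≡ signed σ (magnitude m q)
  blockEntry-at m true q q< with q <? width m
  ... | yes _  = refl
  ... | no q≮  = ⊥-elim (q≮ q<)
  blockEntry-at m false q q< with width m + q <? width m
  ... | yes lt = ⊥-elim (<⇒≱ lt (m≤m+n (width m) q))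
  ... | no _   = cong (λ r → signed false (magnitude m r)) (m+n∸m≡n (width m) q)

  -- Positions 1, 2, … are filled block after block; block m starts after
  -- blockStart m positions.
  blockStart : ℕ → ℕ
  blockStart zero    = 0
  blockStart (suc m) = blockStart m + (width m + width m)

  blockStart-mono : ∀ {m m′} → m ≤ m′ → blockStart m ≤ blockStart m′
  blockStart-mono {m} {zero} z≤n = ≤-refl
  blockStart-mono {m} {suc m′} le with m≤n⇒m<n∨m≡n le
  ... | inj₁ lt   = ≤-trans (blockStart-mono (s≤s⁻¹ lt)) (m≤m+n (blockStart m′) _)
  ... | inj₂ refl = ≤-refl

  before-later-block : ∀ {m m′} o o′ → m < m′ → o < width m + width m →
                       blockStart m + o < blockStart m′ + o′
  before-later-block {m} {m′} o o′ m<m′ o< =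
    ≤-trans (+-monoʳ-< (blockStart m) o<) (≤-trans (blockStart-mono m<m′) (m≤m+n (blockStart m′) o′))

  block-≤ : ∀ m o m′ o′ → blockStart m + o < blockStart m′ + o′ →
            o′ < width m′ + width m′ → m ≤ m′
  block-≤ m o m′ o′ lt o′< with m ≤? m′
  ... | yes le = le
  ... | no  m≰ = ⊥-elim (<-asym lt (before-later-block o′ o (≰⇒> m≰) o′<))

  record Position (i : ℕ) : Set where
    constructor at
    field
      block offs : ℕ
      i≡     : i ≡ blockStart block + offs
      offs<  : offs < width block + width block

  position : ∀ i → Position i
  position zero = at 0 0 refl (s≤s z≤n)
  position (suc i) with position i
  ... | at m o e o< with suc o <? width m + width m
  ...   | yes o+1< = at m (suc o) (trans (cong suc e) (sym (+-suc (blockStart m) o))) o+1<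
  ...   | no  o+1≮ = at (suc m) 0 next-block (s≤s z≤n)
    where
    next-block : suc i ≡ blockStart (suc m) + 0
    next-block = begin
      suc i                      ≡⟨ cong suc e ⟩
      suc (blockStart m + o)     ≡⟨ sym (+-suc (blockStart m) o) ⟩
      blockStart m + suc o       ≡⟨ cong (λ z → blockStart m + z) (≤-antisym o< (≮⇒≥ o+1≮)) ⟩
      blockStart (suc m)         ≡⟨ sym (+-identityʳ _) ⟩
      blockStart (suc m) + 0     ∎
      where open ≡-Reasoning

  position-unique : ∀ m o m′ o′ → blockStart m + o ≡ blockStart m′ + o′ →
                    o < width m + width m → o′ < width m′ + width m′ → m ≡ m′ × o ≡ o′
  position-unique m o m′ o′ e o< o′< with <-cmp m m′
  ... | tri< m<m′ _ _ = ⊥-elim (<⇒≢ (before-later-block o o′ m<m′ o<) e)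
  ... | tri> _ _ m′<m = ⊥-elim (<⇒≢ (before-later-block o′ o m′<m o′<) (sym e))
  ... | tri≈ _ refl _ = refl , +-cancelˡ-≡ (blockStart m) o o′ e

  enumeration : ℕ → ℤ
  enumeration zero    = + 0
  enumeration (suc i) = blockEntry (Position.block p) (Position.offs p)
    where
    p : Position i
    p = position i

  enumeration-at : ∀ m o → o < width m + width m →
                   enumeration (suc (blockStart m + o)) ≡ blockEntry m o
  enumeration-at m o o< with position (blockStart m + o)
  ... | at m′ o′ e o′< with position-unique m o m′ o′ e o< o′<
  ...   | refl , refl = refl

  record Entry (i : ℕ) : Set where
    constructor entry-at
    field
      block rank : ℕ
      sign       : Bool
      rank<      : rank < width block
      placed     : i ≡ blockStart block + offset sign (width block) rank
      value      : enumeration (suc i) ≡ signed sign (magnitude block rank)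

  entry-of : ∀ i → Entry i
  entry-of i = from (position i) refl
    where
    from : (p : Position i) →
           enumeration (suc i) ≡ blockEntry (Position.block p) (Position.offs p) → Entry i
    from (at m o e o<) v with blockEntry m o | blockEntry-view m o o<
    ... | _ | entry σ q q< refl = entry-at m q σ q< e v

  signed-injective : ∀ σ τ x y → signed σ (suc x) ≡ signed τ (suc y) → σ ≡ τ × x ≡ y
  signed-injective true  true  x y refl = refl , refl
  signed-injective false false x y refl = refl , refl
  signed-injective true  false x y ()
  signed-injective false true  x y ()

  signed≢0 : ∀ σ x → signed σ (suc x) ≢ + 0
  signed≢0 true  x ()
  signed≢0 false x ()

  enumeration-injective : ∀ p p′ → enumeration p ≡ enumeration p′ → p ≡ p′
  enumeration-injective zero zero _ = refl
  enumeration-injective zero (suc i) e with entry-of i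
  ... | entry-at m q σ _ _ v = ⊥-elim (signed≢0 σ _ (trans (sym v) (sym e)))
  enumeration-injective (suc i) zero e with entry-of i
  ... | entry-at m q σ _ _ v = ⊥-elim (signed≢0 σ _ (trans (sym v) e))
  enumeration-injective (suc i) (suc i′) e with entry-of i | entry-of i′
  ... | entry-at m q σ q< pl v | entry-at m′ q′ σ′ q′< pl′ v′
    with signed-injective σ σ′ _ _ (trans (sym v) (trans e v′))
  ... | refl , same with magnitude-injective m q m′ q′ q< q′< (cong suc same)
  ... | refl , refl = cong suc (trans pl (sym pl′))

module SignedProgressions where

  open import Data.Nat as ℕ using (ℕ)
  open import Data.Bool using (Bool; true; false)
  open import Relation.Binary.PropositionalEquality
  open import Data.Integer using (ℤ; +_; _+_; -_)
  open import Data.Integer.Properties using (pos-+; +-injective)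
  open import Data.Integer.Tactic.RingSolver using (solve-∀)
  open Blocks using (signed)

  -- If σa·x, σb·y, σc·z (x, y, z ∈ ℕ) satisfy σa·x + σc·z = 2·σb·y, the
  -- magnitudes satisfy one of four relations; x + z = 2y only with equal signs.
  data MagnitudeRelation (σa σb σc : Bool) (x y z : ℕ) : Set where
    same-signs : σa ≡ σb → σc ≡ σb → x ℕ.+ z ≡ y ℕ.+ y → MagnitudeRelation σa σb σc x y z
    first-big  : x ≡ (y ℕ.+ y) ℕ.+ z → MagnitudeRelation σa σb σc x y z
    last-big   : z ≡ (y ℕ.+ y) ℕ.+ x → MagnitudeRelation σa σb σc x y z
    all-zero   : (x ℕ.+ z) ℕ.+ (y ℕ.+ y) ≡ 0 → MagnitudeRelation σa σb σc x y z

  pos-+₃ : ∀ a b c → + ((a ℕ.+ b) ℕ.+ c) ≡ (+ a + + b) + + c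
  pos-+₃ a b c = trans (pos-+ (a ℕ.+ b) c) (cong (_+ + c) (pos-+ a b))

  pos-+₄ : ∀ a b c d → + ((a ℕ.+ b) ℕ.+ (c ℕ.+ d)) ≡ (+ a + + b) + (+ c + + d)
  pos-+₄ a b c d = trans (pos-+ (a ℕ.+ b) (c ℕ.+ d)) (cong₂ _+_ (pos-+ a b) (pos-+ c d))

  magnitude-relation : ∀ σa σb σc x y z →
    signed σa x + signed σc z ≡ signed σb y + signed σb y → MagnitudeRelation σa σb σc x y z
  magnitude-relation true true true x y z e =
    same-signs refl refl (+-injective (trans (pos-+ x z) (trans e (sym (pos-+ y y)))))
  magnitude-relation false false false x y z e =
    same-signs refl refl (+-injective (trans (pos-+ x z) (trans (negate (+ x) (+ z))
      (trans (cong -_ e) (sym (trans (pos-+ y y) (negate (+ y) (+ y))))))))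
    where
    negate : ∀ a c → a + c ≡ - (- a + - c)
    negate = solve-∀
  magnitude-relation true true false x y z e =
    first-big (+-injective (trans (rearrange (+ x) (+ z)) (trans (cong (_+ + z) e) (sym (pos-+₃ y y z)))))
    where
    rearrange : ∀ a c → a ≡ (a + - c) + c
    rearrange = solve-∀
  magnitude-relation false false true x y z e =
    first-big (+-injective (trans (rearrange (+ x) (+ z))
      (trans (cong (λ w → + z + - w) e) (trans (double (+ y) (+ z)) (sym (pos-+₃ y y z))))))
    where
    rearrange : ∀ a c → a ≡ c + - (- a + c)
    rearrange = solve-∀
    double : ∀ b c → c + - (- b + - b) ≡ (b + b) + c
    double = solve-∀
  magnitude-relation true false false x y z e =
    last-big (+-injective (trans (rearrange (+ x) (+ z))
      (trans (cong (λ w → + x + - w) e) (trans (double (+ x) (+ y)) (sym (pos-+₃ y y x))))))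
    where
    rearrange : ∀ a c → c ≡ a + - (a + - c)
    rearrange = solve-∀
    double : ∀ a b → a + - (- b + - b) ≡ (b + b) + a
    double = solve-∀
  magnitude-relation false true true x y z e =
    last-big (+-injective (trans (rearrange (+ x) (+ z)) (trans (cong (_+ + x) e) (sym (pos-+₃ y y x)))))
    where
    rearrange : ∀ a c → c ≡ (- a + c) + a
    rearrange = solve-∀
  magnitude-relation true false true x y z e =
    all-zero (+-injective (trans (pos-+₄ x z y y) (trans (cong (_+ (+ y + + y)) e) (cancel (+ y)))))
    where
    cancel : ∀ b → (- b + - b) + (b + b) ≡ + 0
    cancel = solve-∀
  magnitude-relation false true false x y z e =
    all-zero (+-injective (trans (pos-+₄ x z y y)
      (trans (negate (+ x) (+ y) (+ z)) (trans (cong (λ w → - w + (+ y + + y)) e) (cancel (+ y))))))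
    where
    negate : ∀ a b c → (a + c) + (b + b) ≡ - (- a + - c) + (b + b)
    negate = solve-∀
    cancel : ∀ b → - (b + b) + (b + b) ≡ + 0
    cancel = solve-∀

module Separation where

  open import Data.Nat
  open import Data.Nat.Properties
  open import Data.Product using (_×_; _,_)
  open import Relation.Nullary using (¬_)
  open import Data.Empty using (⊥-elim)
  open import Relation.Binary.PropositionalEquality
  open import Data.Nat.Tactic.RingSolver using (solve-∀)
  open Blocks using (M; base; M≤base)
  open SignedProgressions

  base<double : ∀ m y → base m < y → suc (base m + base m) < y + y
  base<double m y b<y =
    ≤-trans (≤-reflexive (cong suc (sym (+-suc (base m) (base m))))) (+-mono-≤ b<y b<y)

  M-suc<double : ∀ m y → base m < y → M (suc m) < y + y
  M-suc<double m y b<y =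
    ≤-<-trans (s≤s (+-monoʳ-≤ (base m) (m≤m+n (M m + M m) (M m)))) (base<double m y b<y)

  sum<double : ∀ m x y z → x ≤ M m → z ≤ M (suc m) → base m < y → x + z < y + y
  sum<double m x y z x≤ z≤ b<y =
    ≤-<-trans (≤-trans (+-mono-≤ x≤ z≤) (≤-reflexive (six (M m)))) (base<double m y b<y)
    where
    six : ∀ K → K + suc (K + K + K + (K + K)) ≡ suc (K + K + K + (K + K + K))
    six = solve-∀

  all-zero-impossible : ∀ x y z → 0 < z → (x + z) + (y + y) ≢ 0
  all-zero-impossible x y z 0<z e =
    <⇒≢ (≤-trans 0<z (≤-trans (m≤n+m z x) (m≤m+n (x + z) (y + y)))) (sym e)

  last-in-later-block : ∀ {σa σb σc} m x y z → x ≤ M m → y ≤ M m → base m < z →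
                        ¬ MagnitudeRelation σa σb σc x y z
  last-in-later-block m x y z x≤ y≤ b<z (same-signs _ _ e) =
    <⇒≱ b<z (≤-trans (m≤n+m z x)
      (≤-trans (≤-reflexive e) (≤-trans (+-mono-≤ y≤ y≤) (m≤m+n _ (M m)))))
  last-in-later-block m x y z x≤ y≤ b<z (first-big e) =
    <⇒≱ b<z (≤-trans (m≤n+m z (y + y)) (≤-trans (≤-reflexive (sym e)) (≤-trans x≤ (M≤base m))))
  last-in-later-block m x y z x≤ y≤ b<z (last-big e) =
    <⇒≱ b<z (≤-trans (≤-reflexive e) (+-mono-≤ (+-mono-≤ y≤ y≤) x≤))
  last-in-later-block m x y z x≤ y≤ b<z (all-zero e) =
    all-zero-impossible x y z (≤-<-trans z≤n b<z) e

  last-two-in-block : ∀ {σa σb σc} m x y z → x ≤ M m → base m < y → base m < z →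
                      z ≤ M (suc m) → ¬ MagnitudeRelation σa σb σc x y z
  last-two-in-block m x y z x≤ b<y b<z z≤ (same-signs _ _ e) =
    <⇒≢ (sum<double m x y z x≤ z≤ b<y) e
  last-two-in-block m x y z x≤ b<y b<z z≤ (first-big e) =
    <⇒≱ (≤-<-trans (≤-trans x≤ (M≤base m)) b<y)
      (≤-trans (m≤n+m y y) (≤-trans (m≤m+n (y + y) z) (≤-reflexive (sym e))))
  last-two-in-block m x y z x≤ b<y b<z z≤ (last-big e) =
    <⇒≱ (M-suc<double m y b<y) (≤-trans (m≤m+n (y + y) x) (≤-trans (≤-reflexive (sym e)) z≤))
  last-two-in-block m x y z x≤ b<y b<z z≤ (all-zero e) =
    all-zero-impossible x y z (≤-<-trans z≤n b<z) e

  all-in-block : ∀ {σa σb σc} m x y z → base m < y → base m < z →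
                 x ≤ M (suc m) → z ≤ M (suc m) → MagnitudeRelation σa σb σc x y z →
                 σa ≡ σb × σc ≡ σb × x + z ≡ y + y
  all-in-block m x y z b<y b<z x≤ z≤ (same-signs a≡b c≡b e) = a≡b , c≡b , e
  all-in-block m x y z b<y b<z x≤ z≤ (first-big e) =
    ⊥-elim (<⇒≱ (M-suc<double m y b<y) (≤-trans (m≤m+n (y + y) z) (≤-trans (≤-reflexive (sym e)) x≤)))
  all-in-block m x y z b<y b<z x≤ z≤ (last-big e) =
    ⊥-elim (<⇒≱ (M-suc<double m y b<y) (≤-trans (m≤m+n (y + y) x) (≤-trans (≤-reflexive (sym e)) z≤)))
  all-in-block m x y z b<y b<z x≤ z≤ (all-zero e) =
    ⊥-elim (all-zero-impossible x y z (≤-<-trans z≤n b<z) e)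

module NoProgression where

  open import Data.Nat
  open import Data.Nat.Properties
  open import Data.Bool using (true)
  open import Data.Product using (_,_)
  open import Data.Sum using (inj₁; inj₂)
  open import Relation.Binary.PropositionalEquality
  import Data.Integer as ℤ
  open import Data.Nat.Tactic.RingSolver using (solve-∀)
  open APFreeOrder using (listing-AP-free)
  open Blocks
  open SignedProgressions
  open Separation

  entry-block-≤ : ∀ {i j} → i < j → (ei : Entry i) (ej : Entry j) → Entry.block ei ≤ Entry.block ej
  entry-block-≤ i<j (entry-at mi qi σi _ pli _) (entry-at mj qj σj qj< plj _) =
    block-≤ mi _ mj _ (subst₂ _<_ pli plj i<j) (offset-< σj qj<)

  data FirstTerm (i m : ℕ) : Set where
    small      : ∀ σ x → x ≤ M m → enumeration i ≡ signed σ x → FirstTerm i m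
    same-block : ∀ σ q → q < width m → i ≡ suc (blockStart m + offset σ (width m) q) →
                 enumeration i ≡ signed σ (magnitude m q) → FirstTerm i m

  first-term : ∀ i j → i < suc j → (ej : Entry j) → FirstTerm i (Entry.block ej)
  first-term zero    j _ ej = small true 0 z≤n refl
  first-term (suc i) j i<j ej with entry-of i
  ... | ei@(entry-at mi qi σi qi< pli vi) with m≤n⇒m<n∨m≡n (entry-block-≤ (s≤s⁻¹ i<j) ei ej)
  ...   | inj₁ mi<mj = small σi _ (≤-trans (magnitude-≤ mi qi qi<) (M-mono mi<mj)) vi
  ...   | inj₂ refl  = same-block σi qi qi< (cong suc pli) vi

  relation-of : ∀ i j k σi σj σk {x y z} →
    enumeration i ≡ signed σi x → enumeration j ≡ signed σj y → enumeration k ≡ signed σk z →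
    enumeration i ℤ.+ enumeration k ≡ enumeration j ℤ.+ enumeration j →
    MagnitudeRelation σi σj σk x y z
  relation-of i j k σi σj σk {x} {y} {z} vi vj vk E =
    magnitude-relation σi σj σk x y z (trans (cong₂ ℤ._+_ (sym vi) (sym vk)) (trans E (cong₂ ℤ._+_ vj vj)))

  -- Three entries of one block with one sign: their ranks would form an AP
  -- in positional order in the listing of the block, which has none.
  in-one-block : ∀ m σ qi qj qk →
    blockStart m + offset σ (width m) qi < blockStart m + offset σ (width m) qj →
    blockStart m + offset σ (width m) qj < blockStart m + offset σ (width m) qk →
    qk < width m → magnitude m qi + magnitude m qk ≢ magnitude m qj + magnitude m qj
  in-one-block m σ qi qj qk i<j j<k qk< e =
    listing-AP-free (width m) qi qj qk (rank-< i<j) (rank-< j<k) qk< (cancel-base e)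
    where
    rank-< : ∀ {q q′} → blockStart m + offset σ (width m) q < blockStart m + offset σ (width m) q′ →
             q < q′
    rank-< lt = offset-cancel-< σ (+-cancelˡ-< (blockStart m) _ _ lt)
    regroup : ∀ B a c → suc (B + a) + suc (B + c) ≡ suc (suc (B + B)) + (a + c)
    regroup = solve-∀
    cancel-base : ∀ {a b c} → suc (base m + a) + suc (base m + c) ≡ suc (base m + b) + suc (base m + b) →
                  a + c ≡ b + b
    cancel-base {a} {b} {c} e′ =
      +-cancelˡ-≡ (suc (suc (base m + base m))) _ _
        (trans (sym (regroup (base m) a c)) (trans e′ (regroup (base m) b b)))

  -- The enumeration contains no 3-term AP: compare the blocks of the three
  -- terms and apply the matching separation lemma.
  enumeration-AP-free : ∀ i j k → i < j → j < k →
                        enumeration i ℤ.+ enumeration k ≢ enumeration j ℤ.+ enumeration j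
  enumeration-AP-free i (suc j) (suc k) i<j j<k E with entry-of j | entry-of k
  ... | ej@(entry-at mj qj σj qj< plj vj) | ek@(entry-at mk qk σk qk< plk vk)
    with first-term i j i<j ej | m≤n⇒m<n∨m≡n (entry-block-≤ (s≤s⁻¹ j<k) ej ek)
  ... | small σ x x≤ v | inj₁ mj<mk =
    last-in-later-block mk x _ _ (≤-trans x≤ (M-mono (<⇒≤ mj<mk)))
      (≤-trans (magnitude-≤ mj qj qj<) (M-mono mj<mk)) (magnitude-> mk qk)
      (relation-of i (suc j) (suc k) σ σj σk v vj vk E)
  ... | small σ x x≤ v | inj₂ refl =
    last-two-in-block mk x _ _ x≤ (magnitude-> mk qj) (magnitude-> mk qk) (magnitude-≤ mk qk qk<)
      (relation-of i (suc j) (suc k) σ σj σk v vj vk E)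
  ... | same-block σ qi qi< pli vi | inj₁ mj<mk =
    last-in-later-block mk _ _ _ (≤-trans (magnitude-≤ mj qi qi<) (M-mono mj<mk))
      (≤-trans (magnitude-≤ mj qj qj<) (M-mono mj<mk)) (magnitude-> mk qk)
      (relation-of i (suc j) (suc k) σ σj σk vi vj vk E)
  ... | same-block σ qi qi< pli vi | inj₂ refl
    with all-in-block mk _ _ _ (magnitude-> mk qj) (magnitude-> mk qk) (magnitude-≤ mk qi qi<)
           (magnitude-≤ mk qk qk<) (relation-of i (suc j) (suc k) σ σj σk vi vj vk E)
  ...   | refl , refl , sums =
    in-one-block mk σ qi qj qk (s≤s⁻¹ (subst₂ _<_ pli (cong suc plj) i<j))
      (subst₂ _<_ plj plk (s≤s⁻¹ j<k)) qk< sums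

module TheSet where

  open import Data.Nat
  open import Data.Nat.Properties
  open import Data.Bool using (Bool; true; false; _∧_; _∨_; T)
  open import Data.Bool.Properties using (T-≡; T-∧; T-∨)
  open import Function.Bundles using (Equivalence)
  open import Data.Product using (Σ; ∃; _×_; _,_)
  open import Data.Sum using (_⊎_; inj₁; inj₂)
  open import Relation.Binary.PropositionalEquality
  open import Data.Integer as ℤ using (+_; -[1+_]; ∣_∣)
  open import Data.Integer.Tactic.RingSolver using (solve-∀)
  open import Defs using (Subset; _∈S_; PermutationOf; Avoids3AP)
  open APFreeOrder using (listing-surjective)
  open Blocks
  open NoProgression using (enumeration-AP-free)

  -- Magnitudes of S: 0 and the magnitudes of all blocks.  A block m containing
  -- t has m ≤ M m ≤ base m < t, so the blocks below t + 1 suffice.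
  inBlock : ℕ → ℕ → Bool
  inBlock m t = (base m <ᵇ t) ∧ (t ≤ᵇ M (suc m))

  inBlockBelow : ℕ → ℕ → Bool
  inBlockBelow zero    t = false
  inBlockBelow (suc n) t = inBlock n t ∨ inBlockBelow n t

  isMagnitude : ℕ → Bool
  isMagnitude t = (t ≡ᵇ 0) ∨ inBlockBelow (suc t) t

  S : Subset
  S x = isMagnitude ∣ x ∣

  inBlockBelow-intro : ∀ n m t → m < n → base m < t → t ≤ M (suc m) → T (inBlockBelow n t)
  inBlockBelow-intro (suc n) m t m<n b<t t≤ with m≤n⇒m<n∨m≡n (s≤s⁻¹ m<n)
  ... | inj₁ m<n′ = Equivalence.from T-∨ (inj₂ (inBlockBelow-intro n m t m<n′ b<t t≤))
  ... | inj₂ refl = Equivalence.from T-∨ (inj₁ (Equivalence.from T-∧ (<⇒<ᵇ b<t , ≤⇒≤ᵇ t≤)))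

  inBlockBelow-elim : ∀ n t → T (inBlockBelow n t) → Σ ℕ λ m → base m < t × t ≤ M (suc m)
  inBlockBelow-elim (suc n) t h with Equivalence.to T-∨ h
  ... | inj₁ here  = let (b<t , t≤) = Equivalence.to T-∧ here in
                     n , <ᵇ⇒< (base n) t b<t , ≤ᵇ⇒≤ t (M (suc n)) t≤
  ... | inj₂ below = inBlockBelow-elim n t below

  isMagnitude-block : ∀ m t → base m < t → t ≤ M (suc m) → isMagnitude t ≡ true
  isMagnitude-block m (suc t) b<t t≤ = Equivalence.to T-≡
    (inBlockBelow-intro (suc (suc t)) m (suc t) m<t+2 b<t t≤)
    where
    m<t+2 : m < suc (suc t)
    m<t+2 = s≤s (≤-trans (≤-trans (m≤M m) (M≤base m)) (<⇒≤ b<t))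

  isMagnitude-cases : ∀ t → isMagnitude t ≡ true → t ≡ 0 ⊎ Σ ℕ λ m → base m < t × t ≤ M (suc m)
  isMagnitude-cases zero    _ = inj₁ refl
  isMagnitude-cases (suc t) e = inj₂ (inBlockBelow-elim (suc (suc t)) (suc t) (Equivalence.from T-≡ e))

  enumeration-∈S : ∀ p → enumeration p ∈S S
  enumeration-∈S zero    = refl
  enumeration-∈S (suc i) with entry-of i
  ... | entry-at m q σ q< _ v =
    trans (cong S v) (trans (cong isMagnitude (∣signed∣ σ (magnitude m q)))
      (isMagnitude-block m (magnitude m q) (magnitude-> m q) (magnitude-≤ m q q<)))
    where
    ∣signed∣ : ∀ σ x → ∣ signed σ x ∣ ≡ x
    ∣signed∣ true  x       = refl
    ∣signed∣ false zero    = refl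
    ∣signed∣ false (suc x) = refl

  magnitude-surjective : ∀ m t → base m < t → t ≤ M (suc m) →
                         Σ ℕ λ q → q < width m × magnitude m q ≡ t
  magnitude-surjective m t b<t t≤ with listing-surjective (width m) (t ∸ suc (base m)) in-range
    where
    in-range : t ∸ suc (base m) < width m
    in-range = subst (t ∸ suc (base m) <_) (m+n∸m≡n (suc (base m)) (width m))
                 (∸-monoˡ-< (s≤s (subst (t ≤_) (M-suc m) t≤)) b<t)
  ... | q , q< , listed = q , q< , trans (cong (λ r → suc (base m + r)) listed) (m+[n∸m]≡n b<t)

  sign-of : ∀ x → Σ Bool λ σ → signed σ ∣ x ∣ ≡ x
  sign-of (+ n)    = true , refl
  sign-of -[1+ n ] = false , refl

  enumeration-surjective : ∀ x → x ∈S S → ∃ λ i → enumeration i ≡ x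
  enumeration-surjective x x∈S with sign-of x | isMagnitude-cases ∣ x ∣ x∈S
  ... | σ , σ∣x∣≡x | inj₁ ∣x∣≡0 =
    0 , trans (signed-zero σ) (trans (cong (signed σ) (sym ∣x∣≡0)) σ∣x∣≡x)
    where
    signed-zero : ∀ σ → + 0 ≡ signed σ 0
    signed-zero true  = refl
    signed-zero false = refl
  ... | σ , σ∣x∣≡x | inj₂ (m , b<t , t≤) with magnitude-surjective m ∣ x ∣ b<t t≤
  ...   | q , q< , mq = suc (blockStart m + offset σ (width m) q) , (begin
    enumeration (suc (blockStart m + offset σ (width m) q)) ≡⟨ enumeration-at m _ (offset-< σ q<) ⟩
    blockEntry m (offset σ (width m) q)                     ≡⟨ blockEntry-at m σ q q< ⟩
    signed σ (magnitude m q)                                ≡⟨ cong (signed σ) mq ⟩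
    signed σ ∣ x ∣                                          ≡⟨ σ∣x∣≡x ⟩
    x                                                       ∎)
    where open ≡-Reasoning

  permutation : PermutationOf S
  permutation = record
    { seq = enumeration ; injective = enumeration-injective
    ; inS = enumeration-∈S ; onto = enumeration-surjective }

  S-avoids-3AP : Avoids3AP S
  S-avoids-3AP = permutation , λ (i , j , k , a , d , i<j , j<k , _ , vi , vj , vk) →
    enumeration-AP-free i j k i<j j<k
      (trans (cong₂ ℤ._+_ vi vk) (trans (progression a d) (sym (cong₂ ℤ._+_ vj vj))))
    where
    progression : ∀ a d → a ℤ.+ (a ℤ.+ d ℤ.+ d) ≡ (a ℤ.+ d) ℤ.+ (a ℤ.+ d)
    progression = solve-∀

module Counting where

  open import Data.Nat
  open import Data.Nat.Properties
  open import Data.Bool using (Bool; true; false; if_then_else_)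
  open import Relation.Binary.PropositionalEquality
  open import Data.Integer as ℤ using (+_)
  import Data.Integer.Properties as ℤ
  import Data.Integer.Tactic.RingSolver as ℤ-Solver
  open import Data.Nat.Tactic.RingSolver using (solve-∀)
  open import Data.List using (map; applyUpTo)
  open import Data.Nat.ListAction using (sum)
  open import Defs using (count)
  open import Data.Product using (Σ; _×_; _,_)
  open import Data.Sum using (inj₁; inj₂)
  open import Data.Empty using (⊥-elim)
  open import Relation.Nullary using (yes; no)
  open import Relation.Binary.Definitions using (tri<; tri≈; tri>)
  open Blocks using (M; base; width; M-suc; M≤base; base<M-suc; M-mono)
  open TheSet using (S; isMagnitude; isMagnitude-block; isMagnitude-cases)

  indicator : Bool → ℕ
  indicator b = if b then 1 else 0

  Σ< : (ℕ → ℕ) → ℕ → ℕ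
  Σ< f zero    = 0
  Σ< f (suc k) = f 0 + Σ< (λ i → f (suc i)) k

  sum-applyUpTo : ∀ (f h : ℕ → ℕ) k → sum (map f (applyUpTo h k)) ≡ Σ< (λ i → f (h i)) k
  sum-applyUpTo f h zero    = refl
  sum-applyUpTo f h (suc k) = cong (λ z → f (h 0) + z) (sum-applyUpTo f (λ i → h (suc i)) k)

  Σ<-snoc : ∀ f k → Σ< f (suc k) ≡ Σ< f k + f k
  Σ<-snoc f zero    = +-comm (f 0) 0
  Σ<-snoc f (suc k) = trans (cong (λ z → f 0 + z) (Σ<-snoc (λ i → f (suc i)) k)) (sym (+-assoc (f 0) _ _))

  Σ<-cong : ∀ f g k → (∀ i → f i ≡ g i) → Σ< f k ≡ Σ< g k
  Σ<-cong f g zero    _ = refl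
  Σ<-cong f g (suc k) h = cong₂ _+_ (h 0) (Σ<-cong _ _ k (λ i → h (suc i)))

  positives : ℕ → ℕ
  positives zero    = 0
  positives (suc t) = positives t + indicator (isMagnitude (suc t))

  summand : ℕ → ℕ → ℕ
  summand n i = indicator (S (+ i ℤ.- + n))

  count-Σ< : ∀ n → count S n ≡ Σ< (summand n) (suc (2 * n))
  count-Σ< n = sum-applyUpTo (summand n) (λ i → i) (suc (2 * n))

  shift-index : ∀ i n → + suc i ℤ.- + suc n ≡ + i ℤ.- + n
  shift-index i n = trans (cong₂ ℤ._-_ (ℤ.pos-+ 1 i) (ℤ.pos-+ 1 n)) (cancel (+ i) (+ n))
    where
    cancel : ∀ a b → (+ 1 ℤ.+ a) ℤ.- (+ 1 ℤ.+ b) ≡ a ℤ.- b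
    cancel = ℤ-Solver.solve-∀

  last-index : ∀ n → + suc (2 * n) ℤ.- + n ≡ + suc n
  last-index n = trans (cong (ℤ._- + n) (trans (cong +_ (split n)) (ℤ.pos-+ (suc n) n))) (cancel (+ suc n) (+ n))
    where
    split : ∀ n → suc (2 * n) ≡ suc n + n
    split = solve-∀
    cancel : ∀ a b → (a ℤ.+ b) ℤ.- b ≡ a
    cancel = ℤ-Solver.solve-∀

  edge : ℕ → ℕ
  edge n = indicator (isMagnitude (suc n))

  -- S is symmetric, so widening [-n, n] to [-(n+1), n+1] adds the two
  -- endpoints ±(n+1): the first summand and, after re-indexing, the last.
  count-suc : ∀ n → count S (suc n) ≡ edge n + (count S n + edge n)
  count-suc n = begin
    count S (suc n)
      ≡⟨ count-Σ< (suc n) ⟩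
    Σ< (summand (suc n)) (suc (2 * suc n))
      ≡⟨ cong (λ z → Σ< (summand (suc n)) (suc z)) (double-suc n) ⟩
    edge n + Σ< (λ i → summand (suc n) (suc i)) (suc L)
      ≡⟨ cong (λ z → edge n + z) re-indexed ⟩
    edge n + Σ< (summand n) (suc L)
      ≡⟨ cong (λ z → edge n + z) (Σ<-snoc (summand n) L) ⟩
    edge n + (Σ< (summand n) L + summand n L)
      ≡⟨ cong₂ (λ a b → edge n + (a + b)) (sym (count-Σ< n)) right-end ⟩
    edge n + (count S n + edge n)
      ∎
    where
    open ≡-Reasoning
    L : ℕ
    L = suc (2 * n)
    double-suc : ∀ n → 2 * suc n ≡ suc (suc (2 * n))
    double-suc = solve-∀
    re-indexed : Σ< (λ i → summand (suc n) (suc i)) (suc L) ≡ Σ< (summand n) (suc L)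
    re-indexed = Σ<-cong _ (summand n) (suc L) (λ i → cong (λ z → indicator (S z)) (shift-index i n))
    right-end : summand n L ≡ edge n
    right-end = cong (λ z → indicator (S z)) (last-index n)

  count≡ : ∀ n → count S n ≡ suc (positives n + positives n)
  count≡ zero    = refl
  count≡ (suc n) = trans (count-suc n)
    (trans (cong (λ z → edge n + (z + edge n)) (count≡ n)) (regroup (positives n) (edge n)))
    where
    regroup : ∀ p c → c + (suc (p + p) + c) ≡ suc ((p + c) + (p + c))
    regroup = solve-∀

  isMagnitude-gap : ∀ m t → M m < t → t ≤ base m → isMagnitude t ≡ false
  isMagnitude-gap m t M<t t≤ with isMagnitude t in eq
  ... | false = refl
  ... | true with isMagnitude-cases t eq
  ...   | inj₁ refl = ⊥-elim (<⇒≱ M<t z≤n)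
  ...   | inj₂ (m′ , b′<t , t≤′) with <-cmp m′ m
  ...     | tri< m′<m _ _ = ⊥-elim (<⇒≱ M<t (≤-trans t≤′ (M-mono m′<m)))
  ...     | tri≈ _ refl _ = ⊥-elim (<⇒≱ b′<t t≤)
  ...     | tri> _ _ m<m′ = ⊥-elim (<⇒≱ b′<t
              (≤-trans t≤ (≤-trans (<⇒≤ (base<M-suc m)) (≤-trans (M-mono m<m′) (M≤base m′)))))

  positives-run : ∀ a k c → (∀ u → a < u → u ≤ a + k → indicator (isMagnitude u) ≡ c) →
                  positives (a + k) ≡ positives a + k * c
  positives-run a zero    c _ = trans (cong positives (+-identityʳ a)) (sym (+-identityʳ _))
  positives-run a (suc k) c constant = begin
    positives (a + suc k)                                       ≡⟨ cong positives (+-suc a k) ⟩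
    positives (a + k) + indicator (isMagnitude (suc (a + k)))   ≡⟨ cong₂ _+_ (positives-run a k c shorter) last ⟩
    positives a + k * c + c                                     ≡⟨ regroup (positives a) k c ⟩
    positives a + suc k * c                                     ∎
    where
    open ≡-Reasoning
    shorter : ∀ u → a < u → u ≤ a + k → indicator (isMagnitude u) ≡ c
    shorter u a<u u≤ = constant u a<u (≤-trans u≤ (+-monoʳ-≤ a (n≤1+n k)))
    last : indicator (isMagnitude (suc (a + k))) ≡ c
    last = constant (suc (a + k)) (s≤s (m≤m+n a k)) (≤-reflexive (sym (+-suc a k)))
    regroup : ∀ p k c → p + k * c + c ≡ p + suc k * c
    regroup = solve-∀

  positives-in-gap : ∀ m k → M m + k ≤ base m → positives (M m + k) ≡ positives (M m)
  positives-in-gap m k le = begin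
    positives (M m + k)        ≡⟨ positives-run (M m) k 0 empty ⟩
    positives (M m) + k * 0    ≡⟨ cong (λ z → positives (M m) + z) (*-zeroʳ k) ⟩
    positives (M m) + 0        ≡⟨ +-identityʳ _ ⟩
    positives (M m)            ∎
    where
    open ≡-Reasoning
    empty : ∀ u → M m < u → u ≤ M m + k → indicator (isMagnitude u) ≡ 0
    empty u M<u u≤ = cong indicator (isMagnitude-gap m u M<u (≤-trans u≤ le))

  positives-in-block : ∀ m k → base m + k ≤ M (suc m) → positives (base m + k) ≡ positives (M m) + k
  positives-in-block m k le = begin
    positives (base m + k)        ≡⟨ positives-run (base m) k 1 full ⟩
    positives (base m) + k * 1    ≡⟨ cong₂ _+_ base-gap (*-identityʳ k) ⟩
    positives (M m) + k           ∎
    where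
    open ≡-Reasoning
    full : ∀ u → base m < u → u ≤ base m + k → indicator (isMagnitude u) ≡ 1
    full u b<u u≤ = cong indicator (isMagnitude-block m u b<u (≤-trans u≤ le))
    base-gap : positives (base m) ≡ positives (M m)
    base-gap = trans (cong positives (+-assoc (M m) (M m) (M m)))
                 (positives-in-gap m (M m + M m) (≤-reflexive (sym (+-assoc (M m) (M m) (M m)))))

  double-sum : ∀ p w → (p + w) + (p + w) ≡ (p + p) + (w + w)
  double-sum = solve-∀

  positives-M : ∀ m → positives (M m) + positives (M m) ≡ M m + m
  positives-M zero    = refl
  positives-M (suc m) = begin
    positives (M (suc m)) + positives (M (suc m))   ≡⟨ cong (λ z → z + z) block ⟩
    (positives (M m) + width m) + (positives (M m) + width m)
                                                    ≡⟨ double-sum (positives (M m)) (width m) ⟩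
    (positives (M m) + positives (M m)) + (width m + width m)
                                                    ≡⟨ cong (_+ (width m + width m)) (positives-M m) ⟩
    (M m + m) + (width m + width m)                 ≡⟨ next (M m) m ⟩
    M (suc m) + suc m                               ∎
    where
    open ≡-Reasoning
    block : positives (M (suc m)) ≡ positives (M m) + width m
    block = trans (cong positives (M-suc m))
              (positives-in-block m (width m) (≤-reflexive (sym (M-suc m))))
    next : ∀ K m → (K + m) + (suc (K + K) + suc (K + K)) ≡ suc (K + K + K + (K + K)) + suc m
    next = solve-∀

  positives-closed : ∀ m r → M m ≤ r → r ≤ M (suc m) →
                     positives r + positives r ≡ (M m + m) + ((r ∸ base m) + (r ∸ base m))
  positives-closed m r M≤r r≤ with r ≤? base m
  ... | yes r≤b = begin
    positives r + positives r                    ≡⟨ cong (λ z → z + z) in-gap ⟩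
    positives (M m) + positives (M m)            ≡⟨ positives-M m ⟩
    M m + m                                      ≡⟨ sym (+-identityʳ _) ⟩
    (M m + m) + 0                                ≡⟨ cong (λ k → (M m + m) + (k + k)) (sym (m≤n⇒m∸n≡0 r≤b)) ⟩
    (M m + m) + ((r ∸ base m) + (r ∸ base m))    ∎
    where
    open ≡-Reasoning
    in-gap : positives r ≡ positives (M m)
    in-gap = trans (cong positives (sym (m+[n∸m]≡n M≤r)))
               (positives-in-gap m (r ∸ M m) (subst (_≤ base m) (sym (m+[n∸m]≡n M≤r)) r≤b))
  ... | no r≰b = begin
    positives r + positives r                    ≡⟨ cong (λ z → z + z) in-block ⟩
    (positives (M m) + k) + (positives (M m) + k) ≡⟨ double-sum (positives (M m)) k ⟩
    (positives (M m) + positives (M m)) + (k + k) ≡⟨ cong (_+ (k + k)) (positives-M m) ⟩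
    (M m + m) + (k + k)                          ∎
    where
    open ≡-Reasoning
    k : ℕ
    k = r ∸ base m
    b≤r : base m ≤ r
    b≤r = <⇒≤ (≰⇒> r≰b)
    in-block : positives r ≡ positives (M m) + k
    in-block = trans (cong positives (sym (m+[n∸m]≡n b≤r)))
                 (positives-in-block m k (subst (_≤ M (suc m)) (sym (m+[n∸m]≡n b≤r)) r≤))

  scale-of : ∀ r → Σ ℕ λ m → M m ≤ r × r ≤ M (suc m)
  scale-of zero = 0 , z≤n , z≤n
  scale-of (suc r) with scale-of r
  ... | m , M≤r , r≤ with suc r ≤? M (suc m)
  ...   | yes r+1≤ = m , m≤n⇒m≤1+n M≤r , r+1≤
  ...   | no  r+1≰ = suc m , ≤-trans (≤-reflexive (sym r≡)) (n≤1+n r) ,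
                     ≤-trans (s≤s (≤-reflexive r≡)) (M<M-suc (suc m))
    where
    r≡ : r ≡ M (suc m)
    r≡ = ≤-antisym r≤ (≮⇒≥ r+1≰)
    M<M-suc : ∀ m → M m < M (suc m)
    M<M-suc m = ≤-<-trans (M≤base m) (base<M-suc m)

  count-at-scale : ∀ m → M m ≤ count S (M m)
  count-at-scale m = subst (M m ≤_) (sym (trans (count≡ (M m)) (cong suc (positives-M m))))
    (≤-trans (m≤m+n (M m) m) (n≤1+n _))

  count-everywhere : ∀ r → r ≤ count S r * 3
  count-everywhere r with scale-of r
  ... | m , M≤r , r≤ = begin
    r                                        ≤⟨ m≤n+m∸n r (base m) ⟩
    base m + k                               ≤⟨ m≤m+n (base m + k) _ ⟩
    base m + k + (3 + m * 3 + k * 5)         ≡⟨ spread (M m) m k ⟩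
    suc ((M m + m) + (k + k)) * 3            ≡⟨ cong (λ z → suc z * 3) (sym (positives-closed m r M≤r r≤)) ⟩
    suc (positives r + positives r) * 3      ≡⟨ cong (_* 3) (sym (count≡ r)) ⟩
    count S r * 3                            ∎
    where
    open ≤-Reasoning
    k : ℕ
    k = r ∸ base m
    spread : ∀ K m k → K + K + K + k + (3 + m * 3 + k * 5) ≡ suc ((K + m) + (k + k)) * 3
    spread = solve-∀

module Density where

  open import Data.Nat as ℕ using (ℕ; suc; _≥_)
  import Data.Nat.Properties as ℕ
  open import Data.Integer as ℤ using (+_)
  import Data.Integer.Properties as ℤ
  open import Data.Rational using (ℚ; _/_; _-_; _≤_; Positive)
  open import Data.Rational.Properties
    using (toℚᵘ-cancel-≤; toℚᵘ-fromℚᵘ; +-monoʳ-≤; +-identityʳ; neg-antimono-≤; <⇒≤; positive⁻¹)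
  import Data.Rational.Unnormalised as ℚᵘ
  import Data.Rational.Unnormalised.Properties as ℚᵘ
  open import Relation.Binary.PropositionalEquality
  open import Data.Nat.Tactic.RingSolver using (solve-∀)
  open import Defs using (count; density)
  open Blocks using (M; base)
  open TheSet using (S)
  open Counting using (count-at-scale; count-everywhere)

  fraction-≤ : ∀ a b c d → a ℕ.* suc d ℕ.≤ c ℕ.* suc b → (+ a) / suc b ≤ (+ c) / suc d
  fraction-≤ a b c d h = toℚᵘ-cancel-≤
    (ℚᵘ.≤-respʳ-≃ (ℚᵘ.≃-sym (toℚᵘ-fromℚᵘ (ℚᵘ.mkℚᵘ (+ c) d)))
      (ℚᵘ.≤-respˡ-≃ (ℚᵘ.≃-sym (toℚᵘ-fromℚᵘ (ℚᵘ.mkℚᵘ (+ a) b)))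
        (ℚᵘ.*≤* (subst₂ ℤ._≤_ (ℤ.pos-* a (suc d)) (ℤ.pos-* c (suc b)) (ℤ.+≤+ h)))))

  minus-positive-≤ : ∀ p ε → Positive ε → p - ε ≤ p
  minus-positive-≤ p ε ε>0 = subst (p - ε ≤_) (+-identityʳ p)
    (+-monoʳ-≤ p (neg-antimono-≤ (<⇒≤ (positive⁻¹ ε {{ε>0}}))))

  density-≥ : ∀ k n → suc n ℕ.≤ count S (suc n) ℕ.* suc k → (+ 1) / (2 ℕ.* suc k) ≤ density S n
  density-≥ k n h = fraction-≤ 1 _ (count S (suc n)) _
    (subst₂ ℕ._≤_ (double-left (suc n)) (double-right (count S (suc n)) (suc k)) (ℕ.+-mono-≤ h h))
    where
    double-left : ∀ x → x ℕ.+ x ≡ 1 ℕ.* (2 ℕ.* x)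
    double-left = solve-∀
    double-right : ∀ c k → c ℕ.* k ℕ.+ c ℕ.* k ≡ c ℕ.* (2 ℕ.* k)
    double-right = solve-∀

  -- At n + 1 = M (N + 1) the density is at least 1/2, and N ≤ n.
  scale-index : ℕ → ℕ
  scale-index N = base N ℕ.+ (M N ℕ.+ M N)

  scale-index-≥ : ∀ N → scale-index N ≥ N
  scale-index-≥ N = ℕ.≤-trans (Blocks.m≤M N) (ℕ.≤-trans (Blocks.M≤base N) (ℕ.m≤m+n (base N) _))

  density-at-scales : ∀ N → (+ 1) / 2 ≤ density S (scale-index N)
  density-at-scales N = density-≥ 0 (scale-index N)
    (subst (suc (scale-index N) ℕ.≤_) (sym (ℕ.*-identityʳ _)) (count-at-scale (suc N)))

  density-everywhere : ∀ n → (+ 1) / 6 ≤ density S n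
  density-everywhere n = density-≥ 2 n (count-everywhere (suc n))

open import Defs
open import Data.Nat using (ℕ; _≥_)
open import Data.Integer using (+_)
open import Data.Rational using (ℚ; _/_; _-_; _≤_; Positive)
open import Data.Product using (Σ; _×_; _,_)
open import Data.Rational.Properties using (≤-trans)
open TheSet using (S; S-avoids-3AP)
open Density

mainTheorem4 :
    ((ε : ℚ) → Positive ε →
      Σ Subset λ S → Avoids3AP S ×
        ((N : ℕ) → Σ ℕ λ n → n ≥ N × ((+ 1) / 2 - ε) ≤ density S n))
    ×
    ((ε : ℚ) → Positive ε →
      Σ Subset λ S → Avoids3AP S ×
        Σ ℕ λ N → (n : ℕ) → n ≥ N → ((+ 1) / 6 - ε) ≤ density S n)
mainTheorem4 =
  (λ ε ε>0 → S , S-avoids-3AP , λ N → scale-index N , scale-index-≥ N ,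
     ≤-trans (minus-positive-≤ ((+ 1) / 2) ε ε>0) (density-at-scales N)) ,
  (λ ε ε>0 → S , S-avoids-3AP , 0 , λ n _ →
     ≤-trans (minus-positive-≤ ((+ 1) / 6) ε ε>0) (density-everywhere n))
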